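{- Let $G$ be a finite abelian group and let $D$ be a $(v,k,\lambda)$-difference set in $G$, with order $n = k-\lambda$. Let $H$ be a subgroup of $G$ with $[G:H] = r$. Suppose that some coset of $H$ in $G$ contains exactly $s$ elements of $D$. Then \[ \left| s - \frac{k}{r} \right| \leq \sqrt{n}\,\frac{r-1}{r}. \]
   Context: For a finite abelian group $G$ of order $v$, identify a subset $D\subseteq G$ with the group ring element $\sum_{d\in D} d \in \mathbb{Z}G$, and for $a=\sum a_i g_i\in\mathbb{Z}G$ put $a^{(-1)}=\sum a_i g_i^{ -1}$. A $k$-subset $D$ ($k\ge 1$) is a $(v,k,\lambda)$-difference set in $G$ if $DD^{(-1)} = \lambda G + n\cdot 1$ in $\mathbb{Z}G$, where $n = k-\lambda$ is the order of the difference set; equivalently every non-identity element of $G$ is expressible as $ab^{ -1}$ with $a,b\in D$ in exactly $\lambda$ ways. -}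

module Defs where

open import Data.Nat using (ℕ; zero; suc; _+_; _*_)
import Data.Nat
open import Data.Fin using (Fin)
import Data.Fin as F
open import Data.Fin.Subset using (Subset; _∈_; ∣_∣)
open import Data.Fin.Subset.Properties using (_∈?_)
open import Data.Bool using (Bool; true; false; _∧_; if_then_else_)
open import Relation.Nullary.Decidable using (⌊_⌋)
open import Relation.Nullary using (¬_)
open import Relation.Binary.PropositionalEquality using (_≡_)
open import Data.Product using (_×_)
open import Algebra.Structures using (IsAbelianGroup)

count : ∀ {n} → (Fin n → Bool) → ℕ
count {zero}  p = 0
count {suc n} p = (if p F.zero then 1 else 0) + count (λ i → p (F.suc i))

sumFin : ∀ {n} → (Fin n → ℕ) → ℕ
sumFin {zero}  f = 0
sumFin {suc n} f = f F.zero + sumFin (λ i → f (F.suc i))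

-- A finite abelian group of order v, realised (up to isomorphism) on the carrier Fin v,
-- with propositional equality.
record FinAbGroup (v : ℕ) : Set where
  field
    _∙_ : Fin v → Fin v → Fin v
    ε   : Fin v
    _⁻¹ : Fin v → Fin v
    isAbelianGroup : IsAbelianGroup _≡_ _∙_ ε _⁻¹

module _ {v : ℕ} (G : FinAbGroup v) where
  open FinAbGroup G

  diffCount : Subset v → Fin v → ℕ
  diffCount D g = sumFin (λ a → count (λ b →
    ⌊ a ∈? D ⌋ ∧ ⌊ b ∈? D ⌋ ∧ ⌊ (a ∙ (b ⁻¹)) F.≟ g ⌋))

  IsDifferenceSet : Subset v → ℕ → ℕ → Set
  IsDifferenceSet D k lam =
    (∣ D ∣ ≡ k) × (1 Data.Nat.≤ k) × (∀ g → ¬ (g ≡ ε) → diffCount D g ≡ lam)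

  IsSubgroup : Subset v → Set
  IsSubgroup H = (ε ∈ H) × (∀ {x y} → x ∈ H → y ∈ H → (x ∙ y) ∈ H)
                 × (∀ {x} → x ∈ H → (x ⁻¹) ∈ H)

  cosetCount : Subset v → Subset v → Fin v → ℕ
  cosetCount D H g = count (λ x → ⌊ x ∈? D ⌋ ∧ ⌊ ((g ⁻¹) ∙ x) ∈? H ⌋)

-- Write c(x) for the number of elements of D in the coset xH, h = ∣H∣ and v = rh.  Summing over
-- all x ∈ G counts every coset h times, and a double count of pairs gives Σ c = kh and
-- Σ c² = h·P, where P = #{(a,b) ∈ D² : ab⁻¹ ∈ H} = k + λ(h − 1) by the difference-set property.
-- Off the coset gH, where c ≡ s, there remain N = (r − 1)h values with sum S = (k − s)h and
-- sum of squares T = (P − s²)h, so Cauchy–Schwarz S² ≤ NT gives (k − s)² ≤ (r − 1)(P − s²).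
-- Since k² = k + λ(v − 1), the difference (k − λ)(r − 1)² − (rs − k)² is exactly r times the
-- slack of that inequality.

module Submission where

open import Relation.Binary.PropositionalEquality

module IntegerArithmetic where
  open import Data.Integer using (ℤ; _+_; _-_; _*_; _≤_; 0ℤ; 1ℤ; Positive; NonNegative)
  open import Data.Integer.Properties
    using (*-zeroʳ; *-cancelˡ-≤-pos; *-monoˡ-≤-nonNeg; i≤j⇒0≤j-i; 0≤i-j⇒j≤i; i≡j⇒i-j≡0)
  open import Data.Integer.Tactic.RingSolver using (solve-∀)

  private
    solve-for : ∀ {a} b {c : ℤ} → a + b ≡ c → a ≡ c - b
    solve-for {a} b a+b≡c = trans (add-sub a b) (cong (_- b) a+b≡c)
      where
      add-sub : ∀ a b → a ≡ a + b - b
      add-sub = solve-∀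

    0≤x*y⇒0≤y : ∀ x y .{{_ : Positive x}} → 0ℤ ≤ x * y → 0ℤ ≤ y
    0≤x*y⇒0≤y x y 0≤xy = *-cancelˡ-≤-pos 0ℤ y x (subst (_≤ x * y) (sym (*-zeroʳ x)) 0≤xy)

    0≤x⇒0≤y*x : ∀ x y .{{_ : NonNegative y}} → 0ℤ ≤ x → 0ℤ ≤ y * x
    0≤x⇒0≤y*x x y 0≤x = subst (_≤ y * x) (*-zeroʳ y) (*-monoˡ-≤-nonNeg y 0≤x)

  variance-bound : ∀ {h k l r s P S N T : ℤ} .{{_ : Positive h}} .{{_ : NonNegative r}} →
    N + h ≡ r * h → S + h * s ≡ k * h → T + h * (s * s) ≡ h * P →
    P + l ≡ k + l * h → k * k + l ≡ k + l * (r * h) → S * S ≤ N * T →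
    (r * s - k) * (r * s - k) ≤ (k - l) * ((r - 1ℤ) * (r - 1ℤ))
  variance-bound {h} {k} {l} {r} {s} {P} {S} {N} {T} hN hS hT hP hE S²≤NT
    with refl ← solve-for {N} h hN
       | refl ← solve-for {S} (h * s) hS
       | refl ← solve-for {T} (h * (s * s)) hT
    = 0≤i-j⇒j≤i (subst (0ℤ ≤_) (sym gap≡r*X) (0≤x⇒0≤y*x X r 0≤X))
    where
    X : ℤ
    X = (r - 1ℤ) * (P - s * s) - (k - s) * (k - s)

    0≤X : 0ℤ ≤ X
    0≤X = 0≤x*y⇒0≤y h X (0≤x*y⇒0≤y h (h * X) (subst (0ℤ ≤_) (NT-S² h k r s P) (i≤j⇒0≤j-i S²≤NT)))
      where
      NT-S² : ∀ h k r s P →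
        (r * h - h) * (h * P - h * (s * s)) - (k * h - h * s) * (k * h - h * s)
        ≡ h * (h * ((r - 1ℤ) * (P - s * s) - (k - s) * (k - s)))
      NT-S² = solve-∀

    gap≡r*X : (k - l) * ((r - 1ℤ) * (r - 1ℤ)) - (r * s - k) * (r * s - k) ≡ r * X
    gap≡r*X = begin
      (k - l) * ((r - 1ℤ) * (r - 1ℤ)) - (r * s - k) * (r * s - k)
        ≡⟨ expand h k l r s P ⟩
      r * X + (r - 1ℤ) * (k * k + l - (k + l * (r * h))) - r * (r - 1ℤ) * (P + l - (k + l * h))
        ≡⟨ cong₂ (λ e₁ e₂ → r * X + (r - 1ℤ) * e₁ - r * (r - 1ℤ) * e₂)
                 (i≡j⇒i-j≡0 hE) (i≡j⇒i-j≡0 hP) ⟩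
      r * X + (r - 1ℤ) * 0ℤ - r * (r - 1ℤ) * 0ℤ
        ≡⟨ drop-zeros r X ⟩
      r * X ∎
      where
      open ≡-Reasoning
      expand : ∀ h k l r s P →
        (k - l) * ((r - 1ℤ) * (r - 1ℤ)) - (r * s - k) * (r * s - k)
        ≡ r * ((r - 1ℤ) * (P - s * s) - (k - s) * (k - s))
          + (r - 1ℤ) * (k * k + l - (k + l * (r * h))) - r * (r - 1ℤ) * (P + l - (k + l * h))
      expand = solve-∀
      drop-zeros : ∀ r x → r * x + (r - 1ℤ) * 0ℤ - r * (r - 1ℤ) * 0ℤ ≡ r * x
      drop-zeros = solve-∀

open import Defs
open import Algebra.Bundles using (AbelianGroup)
open import Algebra.Structures using (IsGroup; IsAbelianGroup)
open import Data.Bool using (Bool; true; false; not; _∧_; if_then_else_; T)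
open import Data.Fin using (Fin; zero; suc; _≟_)
open import Data.Fin.Permutation using (Permutation′; permutation)
open import Data.Fin.Subset using (Subset; _∈_; ∣_∣; inside; outside)
open import Data.Fin.Subset.Properties using (_∈?_; ∣p∣≤∣x∷p∣)
open import Data.Nat using (ℕ; zero; suc; _+_; _*_; _≤_; _<_; z≤n; s≤s)
open import Data.Nat.Properties hiding (_≟_)
open import Data.Nat.Tactic.RingSolver using (solve-∀)
open import Data.Product using (_,_; proj₁; proj₂)
open import Data.Sum using (inj₁; inj₂)
open import Data.Vec using (_∷_; []; here; there)
open import Function using (_∘_)
open import Level using (0ℓ)
open import Relation.Nullary.Decidable
  using (Dec; yes; no; ⌊_⌋; ⌊⌋-map′; isYes≗does; dec-true; toWitness)
open import Relation.Nullary.Negation using (¬_; contradiction)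
open import Algebra.Properties.Semiring.Sum +-*-semiring
  using (sum; sum-cong-≗; sum-replicate-zero; ∑-distrib-+; ∑-comm; sum-permute; *-distribˡ-sum; *-distribʳ-sum)

𝟙 : Bool → ℕ
𝟙 b = if b then 1 else 0

𝟙∈ : ∀ {n} → Subset n → Fin n → ℕ
𝟙∈ p x = 𝟙 ⌊ x ∈? p ⌋

𝟙-∧ : ∀ a b → 𝟙 (a ∧ b) ≡ 𝟙 a * 𝟙 b
𝟙-∧ true  b = sym (+-identityʳ (𝟙 b))
𝟙-∧ false b = refl

𝟙-idem : ∀ b → 𝟙 b * 𝟙 b ≡ 𝟙 b
𝟙-idem true  = refl
𝟙-idem false = refl

⌊⌋-cong : ∀ {a b} {A : Set a} {B : Set b} (A? : Dec A) (B? : Dec B) → (A → B) → (B → A) → ⌊ A? ⌋ ≡ ⌊ B? ⌋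
⌊⌋-cong (yes _) (yes _) _   _   = refl
⌊⌋-cong (no _)  (no _)  _   _   = refl
⌊⌋-cong (yes a) (no ¬b) A→B _   = contradiction (A→B a) ¬b
⌊⌋-cong (no ¬a) (yes b) _   B→A = contradiction (B→A b) ¬a

sumFin≡sum : ∀ {n} (f : Fin n → ℕ) → sumFin f ≡ sum f
sumFin≡sum {zero}  f = refl
sumFin≡sum {suc n} f = cong (f zero +_) (sumFin≡sum (f ∘ suc))

count≡sum : ∀ {n} (p : Fin n → Bool) → count p ≡ sum (𝟙 ∘ p)
count≡sum {zero}  p = refl
count≡sum {suc n} p = cong (𝟙 (p zero) +_) (count≡sum (p ∘ suc))

∣p∣≡sum : ∀ {n} (p : Subset n) → ∣ p ∣ ≡ sum (𝟙∈ p)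
∣p∣≡sum []            = refl
∣p∣≡sum (inside ∷ p)  = cong suc (trans (∣p∣≡sum p) (sum-cong-≗ (λ i → cong 𝟙 (sym (⌊⌋-map′ _ _ (i ∈? p))))))
∣p∣≡sum (outside ∷ p) = trans (∣p∣≡sum p) (sum-cong-≗ (λ i → cong 𝟙 (sym (⌊⌋-map′ _ _ (i ∈? p)))))

x∈p⇒0<∣p∣ : ∀ {n} {x : Fin n} {p : Subset n} → x ∈ p → 0 < ∣ p ∣
x∈p⇒0<∣p∣ here                    = s≤s z≤n
x∈p⇒0<∣p∣ {p = b ∷ p} (there x∈p) = <-≤-trans (x∈p⇒0<∣p∣ x∈p) (∣p∣≤∣x∷p∣ b p)

sum-const : ∀ n c → sum {n} (λ _ → c) ≡ n * c
sum-const zero    c = refl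
sum-const (suc n) c = cong (c +_) (sum-const n c)

sum-mono-≤ : ∀ {n} {f g : Fin n → ℕ} → (∀ i → f i ≤ g i) → sum f ≤ sum g
sum-mono-≤ {zero}  f≤g = z≤n
sum-mono-≤ {suc n} f≤g = +-mono-≤ (f≤g zero) (sum-mono-≤ (f≤g ∘ suc))

sum-*-sum : ∀ {m n} (f : Fin m → ℕ) (g : Fin n → ℕ) → sum f * sum g ≡ sum (λ i → sum (λ j → f i * g j))
sum-*-sum f g = trans (*-distribʳ-sum (sum g) f) (sum-cong-≗ (λ i → *-distribˡ-sum (f i) g))

sum-δ : ∀ {n} (f : Fin n → ℕ) (i : Fin n) → sum (λ j → f j * 𝟙 ⌊ i ≟ j ⌋) ≡ f i
sum-δ {suc n} f zero =
  trans (cong₂ _+_ (*-identityʳ (f zero)) (trans (sum-cong-≗ (λ j → *-zeroʳ (f (suc j)))) (sum-replicate-zero n)))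
        (+-identityʳ (f zero))
sum-δ {suc n} f (suc i) =
  trans (cong₂ _+_ (*-zeroʳ (f zero)) (sum-cong-≗ (λ j → cong (λ b → f (suc j) * 𝟙 b) (⌊⌋-map′ _ _ (i ≟ j)))))
        (sum-δ (f ∘ suc) i)

sum-split-const : ∀ {n} (b : Fin n → Bool) (f : Fin n → ℕ) (a : ℕ) → (∀ i → T (b i) → f i ≡ a) →
  sum (λ i → 𝟙 (not (b i)) * f i) + sum (𝟙 ∘ b) * a ≡ sum f
sum-split-const b f a f≡a = begin
  sum (λ i → 𝟙 (not (b i)) * f i) + sum (𝟙 ∘ b) * a
    ≡⟨ cong (sum (λ i → 𝟙 (not (b i)) * f i) +_) (*-distribʳ-sum a (𝟙 ∘ b)) ⟩
  sum (λ i → 𝟙 (not (b i)) * f i) + sum (λ i → 𝟙 (b i) * a)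
    ≡⟨ sym (∑-distrib-+ (λ i → 𝟙 (not (b i)) * f i) (λ i → 𝟙 (b i) * a)) ⟩
  sum (λ i → 𝟙 (not (b i)) * f i + 𝟙 (b i) * a)
    ≡⟨ sum-cong-≗ (λ i → split (b i) (f≡a i)) ⟩
  sum f ∎
  where
  open ≡-Reasoning
  split : ∀ c {x} → (T c → x ≡ a) → 𝟙 (not c) * x + 𝟙 c * a ≡ x
  split true      x≡a = trans (+-identityʳ a) (sym (x≡a _))
  split false {x} _   = trans (+-identityʳ (x + 0)) (+-identityʳ x)

private
  2ab≤a²+b²-ordered : ∀ {a b} → a ≤ b → 2 * (a * b) ≤ a * a + b * b
  2ab≤a²+b²-ordered {a} a≤b with m≤n⇒∃[o]m+o≡n a≤b
  ... | d , refl = subst (2 * (a * (a + d)) ≤_) (sym (square-expand a d)) (m≤m+n _ (d * d))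
    where
    square-expand : ∀ a d → a * a + (a + d) * (a + d) ≡ 2 * (a * (a + d)) + d * d
    square-expand = solve-∀

2ab≤a²+b² : ∀ a b → 2 * (a * b) ≤ a * a + b * b
2ab≤a²+b² a b with ≤-total a b
... | inj₁ a≤b = 2ab≤a²+b²-ordered a≤b
... | inj₂ b≤a = subst₂ _≤_ (cong (2 *_) (*-comm b a)) (+-comm (b * b) (a * a)) (2ab≤a²+b²-ordered b≤a)

cauchy-schwarz : ∀ {n} (w c : Fin n → ℕ) →
  sum (λ i → w i * c i) * sum (λ i → w i * c i) ≤ sum w * sum (λ i → w i * (c i * c i))
cauchy-schwarz {n} w c = *-cancelˡ-≤ 2 (begin
  2 * (sum wc * sum wc)
    ≡⟨ cong (2 *_) (sum-*-sum wc wc) ⟩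
  2 * sum (λ i → sum (λ j → wc i * wc j))
    ≡⟨ trans (*-distribˡ-sum 2 (λ i → sum (λ j → wc i * wc j)))
             (sum-cong-≗ (λ i → *-distribˡ-sum 2 (λ j → wc i * wc j))) ⟩
  sum (λ i → sum (λ j → 2 * (wc i * wc j)))
    ≤⟨ sum-mono-≤ (λ i → sum-mono-≤ (λ j → pointwise i j)) ⟩
  sum (λ i → sum (λ j → wcc i * w j + w i * wcc j))
    ≡⟨ trans (sum-cong-≗ (λ i → ∑-distrib-+ (λ j → wcc i * w j) (λ j → w i * wcc j)))
             (∑-distrib-+ (λ i → sum (λ j → wcc i * w j)) (λ i → sum (λ j → w i * wcc j))) ⟩
  sum (λ i → sum (λ j → wcc i * w j)) + sum (λ i → sum (λ j → w i * wcc j))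
    ≡⟨ sym (cong₂ _+_ (sum-*-sum wcc w) (sum-*-sum w wcc)) ⟩
  sum wcc * sum w + sum w * sum wcc
    ≡⟨ cong (_+ sum w * sum wcc) (*-comm (sum wcc) (sum w)) ⟩
  sum w * sum wcc + sum w * sum wcc
    ≡⟨ cong (sum w * sum wcc +_) (sym (+-identityʳ _)) ⟩
  2 * (sum w * sum wcc) ∎)
  where
  open ≤-Reasoning
  wc wcc : Fin n → ℕ
  wc i = w i * c i
  wcc i = w i * (c i * c i)
  pointwise : ∀ i j → 2 * (wc i * wc j) ≤ wcc i * w j + w i * wcc j
  pointwise i j = subst₂ _≤_ (lhs (w i) (w j) (c i) (c j)) (rhs (w i) (w j) (c i) (c j))
                    (*-monoʳ-≤ (w i * w j) (2ab≤a²+b² (c i) (c j)))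
    where
    lhs : ∀ u v a b → u * v * (2 * (a * b)) ≡ 2 * ((u * a) * (v * b))
    lhs = solve-∀
    rhs : ∀ u v a b → u * v * (a * a + b * b) ≡ u * (a * a) * v + u * (v * (b * b))
    rhs = solve-∀

module _ {v : ℕ} (G : FinAbGroup v) where
  open FinAbGroup G
  open IsAbelianGroup isAbelianGroup using (isGroup; assoc; comm)
  open IsGroup isGroup using (_\\_; _//_)

  private
    abelianGroup : AbelianGroup 0ℓ 0ℓ
    abelianGroup = record { isAbelianGroup = isAbelianGroup }

  open import Algebra.Properties.AbelianGroup abelianGroup
    using ( \\-leftDividesˡ; \\-leftDividesʳ; ⁻¹-involutive; ⁻¹-anti-homo-\\; ⁻¹-anti-homo-//
          ; comm⇒\\≗flip-//; x∙y⁻¹≈ε⇒x≈y; x≈y⇒x∙y⁻¹≈ε)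

  translation : Fin v → Permutation′ v
  translation g = permutation (g \\_) (g ∙_) (\\-leftDividesʳ g) (\\-leftDividesˡ g)

  sum-translate : ∀ g (f : Fin v → ℕ) → sum (λ x → f (g \\ x)) ≡ sum f
  sum-translate g f = sym (sum-permute f (translation g))

  -- Σ_{a,b ∈ D} w(ab⁻¹): the group-ring element DD⁽⁻¹⁾ paired with w.
  pairSum : Subset v → (Fin v → ℕ) → ℕ
  pairSum D w = sum (λ a → sum (λ b → 𝟙∈ D a * (𝟙∈ D b * w (a // b))))

  module _ (D : Subset v) where
    diffCount≡pairSum : ∀ g → diffCount G D g ≡ pairSum D (λ x → 𝟙 ⌊ x ≟ g ⌋)
    diffCount≡pairSum g =
      trans (sumFin≡sum (λ a → count (λ b → ⌊ a ∈? D ⌋ ∧ ⌊ b ∈? D ⌋ ∧ ⌊ a // b ≟ g ⌋)))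
            (sum-cong-≗ (λ a → trans (count≡sum (λ b → ⌊ a ∈? D ⌋ ∧ ⌊ b ∈? D ⌋ ∧ ⌊ a // b ≟ g ⌋))
              (sum-cong-≗ (λ b → trans (𝟙-∧ ⌊ a ∈? D ⌋ _) (cong (𝟙∈ D a *_) (𝟙-∧ ⌊ b ∈? D ⌋ _))))))

    diffCount-ε : diffCount G D ε ≡ ∣ D ∣
    diffCount-ε = begin
      diffCount G D ε
        ≡⟨ diffCount≡pairSum ε ⟩
      sum (λ a → sum (λ b → 𝟙∈ D a * (𝟙∈ D b * 𝟙 ⌊ a // b ≟ ε ⌋)))
        ≡⟨ sum-cong-≗ (λ a → sum-cong-≗ (λ b → cong (λ t → 𝟙∈ D a * (𝟙∈ D b * 𝟙 t))
             (⌊⌋-cong (a // b ≟ ε) (a ≟ b) (x∙y⁻¹≈ε⇒x≈y a b) x≈y⇒x∙y⁻¹≈ε))) ⟩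
      sum (λ a → sum (λ b → 𝟙∈ D a * (𝟙∈ D b * 𝟙 ⌊ a ≟ b ⌋)))
        ≡⟨ sum-cong-≗ (λ a → sym (*-distribˡ-sum (𝟙∈ D a) (λ b → 𝟙∈ D b * 𝟙 ⌊ a ≟ b ⌋))) ⟩
      sum (λ a → 𝟙∈ D a * sum (λ b → 𝟙∈ D b * 𝟙 ⌊ a ≟ b ⌋))
        ≡⟨ sum-cong-≗ (λ a → trans (cong (𝟙∈ D a *_) (sum-δ (𝟙∈ D) a)) (𝟙-idem ⌊ a ∈? D ⌋)) ⟩
      sum (𝟙∈ D)
        ≡⟨ sym (∣p∣≡sum D) ⟩
      ∣ D ∣ ∎
      where open ≡-Reasoning

    ∑w·diffCount≡pairSum : ∀ w → sum (λ g → w g * diffCount G D g) ≡ pairSum D w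
    ∑w·diffCount≡pairSum w = begin
      sum (λ g → w g * diffCount G D g)
        ≡⟨ sum-cong-≗ (λ g → cong (w g *_) (diffCount≡pairSum g)) ⟩
      sum (λ g → w g * sum (λ a → sum (λ b → F a b g)))
        ≡⟨ sum-cong-≗ (λ g → trans (*-distribˡ-sum (w g) (λ a → sum (λ b → F a b g)))
             (sum-cong-≗ (λ a → *-distribˡ-sum (w g) (λ b → F a b g)))) ⟩
      sum (λ g → sum (λ a → sum (λ b → w g * F a b g)))
        ≡⟨ trans (∑-comm (λ g a → sum (λ b → w g * F a b g)))
                 (sum-cong-≗ (λ a → ∑-comm (λ g b → w g * F a b g))) ⟩
      sum (λ a → sum (λ b → sum (λ g → w g * F a b g)))
        ≡⟨ sum-cong-≗ (λ a → sum-cong-≗ (λ b → sum-over-g a b)) ⟩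
      pairSum D w ∎
      where
      open ≡-Reasoning
      F : Fin v → Fin v → Fin v → ℕ
      F a b g = 𝟙∈ D a * (𝟙∈ D b * 𝟙 ⌊ a // b ≟ g ⌋)
      rearrange : ∀ x y z t → x * (y * (z * t)) ≡ y * z * (x * t)
      rearrange = solve-∀
      sum-over-g : ∀ a b → sum (λ g → w g * F a b g) ≡ 𝟙∈ D a * (𝟙∈ D b * w (a // b))
      sum-over-g a b = begin
        sum (λ g → w g * F a b g)
          ≡⟨ sum-cong-≗ (λ g → rearrange (w g) (𝟙∈ D a) (𝟙∈ D b) (𝟙 ⌊ a // b ≟ g ⌋)) ⟩
        sum (λ g → 𝟙∈ D a * 𝟙∈ D b * (w g * 𝟙 ⌊ a // b ≟ g ⌋))
          ≡⟨ sym (*-distribˡ-sum (𝟙∈ D a * 𝟙∈ D b) (λ g → w g * 𝟙 ⌊ a // b ≟ g ⌋)) ⟩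
        𝟙∈ D a * 𝟙∈ D b * sum (λ g → w g * 𝟙 ⌊ a // b ≟ g ⌋)
          ≡⟨ cong (𝟙∈ D a * 𝟙∈ D b *_) (sum-δ w (a // b)) ⟩
        𝟙∈ D a * 𝟙∈ D b * w (a // b)
          ≡⟨ *-assoc (𝟙∈ D a) (𝟙∈ D b) (w (a // b)) ⟩
        𝟙∈ D a * (𝟙∈ D b * w (a // b)) ∎

  module _ {D : Subset v} {k lam : ℕ} (D-diff : IsDifferenceSet G D k lam) where
    private
      ∣D∣≡k : ∣ D ∣ ≡ k
      ∣D∣≡k = proj₁ D-diff
      diffCount≡λ : ∀ g → ¬ (g ≡ ε) → diffCount G D g ≡ lam
      diffCount≡λ = proj₂ (proj₂ D-diff)

    -- DD⁽⁻¹⁾ = λG + n paired with w, with λ·w(ε) moved across so that no subtraction occurs.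
    pairSum-weighted : ∀ w → pairSum D w + lam * w ε ≡ w ε * k + lam * sum w
    pairSum-weighted w = begin
      pairSum D w + lam * w ε
        ≡⟨ cong₂ _+_ (sym (∑w·diffCount≡pairSum D w)) (cong (lam *_) (sym (sum-δ w ε))) ⟩
      sum (λ g → w g * diffCount G D g) + lam * sum (λ g → w g * δ g)
        ≡⟨ cong (sum (λ g → w g * diffCount G D g) +_) (*-distribˡ-sum lam (λ g → w g * δ g)) ⟩
      sum (λ g → w g * diffCount G D g) + sum (λ g → lam * (w g * δ g))
        ≡⟨ sym (∑-distrib-+ (λ g → w g * diffCount G D g) (λ g → lam * (w g * δ g))) ⟩
      sum (λ g → w g * diffCount G D g + lam * (w g * δ g))
        ≡⟨ sum-cong-≗ pointwise ⟩
      sum (λ g → w g * k * δ g + lam * w g)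
        ≡⟨ ∑-distrib-+ (λ g → w g * k * δ g) (λ g → lam * w g) ⟩
      sum (λ g → w g * k * δ g) + sum (λ g → lam * w g)
        ≡⟨ cong₂ _+_ (sum-δ (λ g → w g * k) ε) (sym (*-distribˡ-sum lam w)) ⟩
      w ε * k + lam * sum w ∎
      where
      open ≡-Reasoning
      δ : Fin v → ℕ
      δ g = 𝟙 ⌊ ε ≟ g ⌋
      pointwise : ∀ g → w g * diffCount G D g + lam * (w g * δ g) ≡ w g * k * δ g + lam * w g
      pointwise g with ε ≟ g
      ... | yes refl rewrite diffCount-ε D | ∣D∣≡k = at-ε (w ε) k lam
        where
        at-ε : ∀ x k l → x * k + l * (x * 1) ≡ x * k * 1 + l * x
        at-ε = solve-∀
      ... | no ε≢g rewrite diffCount≡λ g (ε≢g ∘ sym) = off-ε (w g) k lam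
        where
        off-ε : ∀ x k l → x * l + l * (x * 0) ≡ x * k * 0 + l * x
        off-ε = solve-∀

    k*k+λ≡k+λ*v : k * k + lam ≡ k + lam * v
    k*k+λ≡k+λ*v = begin
      k * k + lam
        ≡⟨ cong₂ _+_ (sym pairSum-1) (sym (*-identityʳ lam)) ⟩
      pairSum D (λ _ → 1) + lam * 1
        ≡⟨ pairSum-weighted (λ _ → 1) ⟩
      1 * k + lam * sum {v} (λ _ → 1)
        ≡⟨ cong₂ _+_ (*-identityˡ k) (cong (lam *_) (trans (sum-const v 1) (*-identityʳ v))) ⟩
      k + lam * v ∎
      where
      open ≡-Reasoning
      pairSum-1 : pairSum D (λ _ → 1) ≡ k * k
      pairSum-1 = begin
        pairSum D (λ _ → 1)
          ≡⟨ sum-cong-≗ (λ a → sum-cong-≗ (λ b → cong (𝟙∈ D a *_) (*-identityʳ (𝟙∈ D b)))) ⟩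
        sum (λ a → sum (λ b → 𝟙∈ D a * 𝟙∈ D b))
          ≡⟨ sym (sum-*-sum (𝟙∈ D) (𝟙∈ D)) ⟩
        sum (𝟙∈ D) * sum (𝟙∈ D)
          ≡⟨ cong (λ t → t * t) (trans (sym (∣p∣≡sum D)) ∣D∣≡k) ⟩
        k * k ∎

    pairSum-subgroup : ∀ {H} → ε ∈ H → pairSum D (𝟙∈ H) + lam ≡ k + lam * ∣ H ∣
    pairSum-subgroup {H} ε∈H = begin
      pairSum D (𝟙∈ H) + lam
        ≡⟨ cong (pairSum D (𝟙∈ H) +_) (trans (sym (*-identityʳ lam)) (cong (lam *_) (sym 𝟙∈H-ε))) ⟩
      pairSum D (𝟙∈ H) + lam * 𝟙∈ H ε
        ≡⟨ pairSum-weighted (𝟙∈ H) ⟩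
      𝟙∈ H ε * k + lam * sum (𝟙∈ H)
        ≡⟨ cong₂ (λ t u → t * k + lam * u) 𝟙∈H-ε (sym (∣p∣≡sum H)) ⟩
      1 * k + lam * ∣ H ∣
        ≡⟨ cong (_+ lam * ∣ H ∣) (*-identityˡ k) ⟩
      k + lam * ∣ H ∣ ∎
      where
      open ≡-Reasoning
      𝟙∈H-ε : 𝟙∈ H ε ≡ 1
      𝟙∈H-ε = cong 𝟙 (trans (isYes≗does (ε ∈? H)) (dec-true (ε ∈? H) ε∈H))

  module _ {H : Subset v} (H≤G : IsSubgroup G H) where
    private
      ∙-closed : ∀ {x y} → x ∈ H → y ∈ H → x ∙ y ∈ H
      ∙-closed = proj₁ (proj₂ H≤G)
      ⁻¹-closed : ∀ {x} → x ∈ H → x ⁻¹ ∈ H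
      ⁻¹-closed = proj₂ (proj₂ H≤G)

    infix 4 _~_ _~?_
    _~_ : Fin v → Fin v → Set
    x ~ y = x \\ y ∈ H

    _~?_ : ∀ x y → Dec (x ~ y)
    x ~? y = x \\ y ∈? H

    ~-sym : ∀ {x y} → x ~ y → y ~ x
    ~-sym {x} {y} x~y = subst (_∈ H) (⁻¹-anti-homo-\\ x y) (⁻¹-closed x~y)

    ~-trans : ∀ {x y z} → x ~ y → y ~ z → x ~ z
    ~-trans {x} {y} {z} x~y y~z = subst (_∈ H) \\-cancel (∙-closed x~y y~z)
      where
      \\-cancel : (x \\ y) ∙ (y \\ z) ≡ x \\ z
      \\-cancel = trans (assoc (x ⁻¹) y (y \\ z)) (cong (x ⁻¹ ∙_) (\\-leftDividesˡ y z))

    ~?-sym : ∀ x y → ⌊ x ~? y ⌋ ≡ ⌊ y ~? x ⌋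
    ~?-sym x y = ⌊⌋-cong (x ~? y) (y ~? x) ~-sym ~-sym

    ~?-resp : ∀ {x y} z → x ~ y → ⌊ y ~? z ⌋ ≡ ⌊ x ~? z ⌋
    ~?-resp {x} {y} z x~y = ⌊⌋-cong (y ~? z) (x ~? z) (~-trans x~y) (~-trans (~-sym x~y))

    ~?≡//∈? : ∀ {x y} → ⌊ x ~? y ⌋ ≡ ⌊ x // y ∈? H ⌋
    ~?≡//∈? {x} {y} = ⌊⌋-cong (x ~? y) (x // y ∈? H)
      (λ x~y → subst (_∈ H) (trans (cong _⁻¹ \\≡//⁻¹) (⁻¹-involutive (x // y))) (⁻¹-closed x~y))
      (λ x//y∈H → subst (_∈ H) (sym \\≡//⁻¹) (⁻¹-closed x//y∈H))
      where
      \\≡//⁻¹ : x \\ y ≡ (x // y) ⁻¹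
      \\≡//⁻¹ = trans (comm⇒\\≗flip-// comm x y) (sym (⁻¹-anti-homo-// x y))

    coset-size : ∀ g → sum (λ x → 𝟙 ⌊ g ~? x ⌋) ≡ ∣ H ∣
    coset-size g = trans (sum-translate g (𝟙∈ H)) (sym (∣p∣≡sum H))

    coset-size′ : ∀ g → sum (λ x → 𝟙 ⌊ x ~? g ⌋) ≡ ∣ H ∣
    coset-size′ g = trans (sum-cong-≗ (λ x → cong 𝟙 (~?-sym x g))) (coset-size g)

    outsideCoset : Fin v → Fin v → ℕ
    outsideCoset g x = 𝟙 (not ⌊ g ~? x ⌋)

    sum-split-coset : ∀ g (f : Fin v → ℕ) → (∀ {x} → g ~ x → f x ≡ f g) →
      sum (λ x → outsideCoset g x * f x) + ∣ H ∣ * f g ≡ sum f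
    sum-split-coset g f f-const =
      trans (cong (λ t → sum (λ x → outsideCoset g x * f x) + t * f g) (sym (coset-size g)))
            (sum-split-const (λ x → ⌊ g ~? x ⌋) f (f g) (λ _ g~x → f-const (toWitness g~x)))

    module _ (D : Subset v) where
      cosetCount≡sum : ∀ x → cosetCount G D H x ≡ sum (λ y → 𝟙∈ D y * 𝟙 ⌊ x ~? y ⌋)
      cosetCount≡sum x = trans (count≡sum (λ y → ⌊ y ∈? D ⌋ ∧ ⌊ x ~? y ⌋))
                               (sum-cong-≗ (λ y → 𝟙-∧ ⌊ y ∈? D ⌋ ⌊ x ~? y ⌋))

      cosetCount-resp : ∀ {x y} → x ~ y → cosetCount G D H y ≡ cosetCount G D H x
      cosetCount-resp {x} {y} x~y =
        trans (cosetCount≡sum y)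
              (trans (sum-cong-≗ (λ z → cong (λ b → 𝟙∈ D z * 𝟙 b) (~?-resp z x~y))) (sym (cosetCount≡sum x)))

      sum-cosetCount : sum (cosetCount G D H) ≡ ∣ D ∣ * ∣ H ∣
      sum-cosetCount = begin
        sum (cosetCount G D H)
          ≡⟨ sum-cong-≗ cosetCount≡sum ⟩
        sum (λ x → sum (λ y → 𝟙∈ D y * 𝟙 ⌊ x ~? y ⌋))
          ≡⟨ ∑-comm (λ x y → 𝟙∈ D y * 𝟙 ⌊ x ~? y ⌋) ⟩
        sum (λ y → sum (λ x → 𝟙∈ D y * 𝟙 ⌊ x ~? y ⌋))
          ≡⟨ sum-cong-≗ (λ y → sym (*-distribˡ-sum (𝟙∈ D y) (λ x → 𝟙 ⌊ x ~? y ⌋))) ⟩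
        sum (λ y → 𝟙∈ D y * sum (λ x → 𝟙 ⌊ x ~? y ⌋))
          ≡⟨ sum-cong-≗ (λ y → cong (𝟙∈ D y *_) (coset-size′ y)) ⟩
        sum (λ y → 𝟙∈ D y * ∣ H ∣)
          ≡⟨ sym (*-distribʳ-sum ∣ H ∣ (𝟙∈ D)) ⟩
        sum (𝟙∈ D) * ∣ H ∣
          ≡⟨ cong (_* ∣ H ∣) (sym (∣p∣≡sum D)) ⟩
        ∣ D ∣ * ∣ H ∣ ∎
        where open ≡-Reasoning

      sum-cosetCount² : sum (λ x → cosetCount G D H x * cosetCount G D H x) ≡ ∣ H ∣ * pairSum D (𝟙∈ H)
      sum-cosetCount² = begin
        sum (λ x → cosetCount G D H x * cosetCount G D H x)
          ≡⟨ sum-cong-≗ (λ x → trans (cong₂ _*_ (cosetCount≡sum x) (cosetCount≡sum x))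
               (sum-*-sum (λ a → 𝟙∈ D a * 𝟙 ⌊ x ~? a ⌋) (λ b → 𝟙∈ D b * 𝟙 ⌊ x ~? b ⌋))) ⟩
        sum (λ x → sum (λ a → sum (λ b → Q x a b)))
          ≡⟨ trans (∑-comm (λ x a → sum (λ b → Q x a b))) (sum-cong-≗ (λ a → ∑-comm (λ x b → Q x a b))) ⟩
        sum (λ a → sum (λ b → sum (λ x → Q x a b)))
          ≡⟨ sum-cong-≗ (λ a → sum-cong-≗ (λ b → sum-over-x a b)) ⟩
        sum (λ a → sum (λ b → ∣ H ∣ * R a b))
          ≡⟨ trans (sum-cong-≗ (λ a → sym (*-distribˡ-sum ∣ H ∣ (R a))))
                   (sym (*-distribˡ-sum ∣ H ∣ (λ a → sum (R a)))) ⟩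
        ∣ H ∣ * pairSum D (𝟙∈ H) ∎
        where
        open ≡-Reasoning
        Q : Fin v → Fin v → Fin v → ℕ
        Q x a b = (𝟙∈ D a * 𝟙 ⌊ x ~? a ⌋) * (𝟙∈ D b * 𝟙 ⌊ x ~? b ⌋)
        R : Fin v → Fin v → ℕ
        R a b = 𝟙∈ D a * (𝟙∈ D b * 𝟙∈ H (a // b))
        same-coset : ∀ x a b → Q x a b ≡ 𝟙 ⌊ x ~? a ⌋ * R a b
        same-coset x a b with x ~? a
        ... | yes x~a =
          trans (cong (λ t → (𝟙∈ D a * 1) * (𝟙∈ D b * 𝟙 t)) (trans (~?-resp b (~-sym x~a)) ~?≡//∈?))
                (unit (𝟙∈ D a) (𝟙∈ D b) (𝟙∈ H (a // b)))
          where
          unit : ∀ p q t → (p * 1) * (q * t) ≡ 1 * (p * (q * t))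
          unit = solve-∀
        ... | no _ = annihilate (𝟙∈ D a) (𝟙∈ D b * 𝟙 ⌊ x ~? b ⌋)
          where
          annihilate : ∀ p q → (p * 0) * q ≡ 0
          annihilate = solve-∀
        sum-over-x : ∀ a b → sum (λ x → Q x a b) ≡ ∣ H ∣ * R a b
        sum-over-x a b = begin
          sum (λ x → Q x a b)               ≡⟨ sum-cong-≗ (λ x → same-coset x a b) ⟩
          sum (λ x → 𝟙 ⌊ x ~? a ⌋ * R a b)  ≡⟨ sym (*-distribʳ-sum (R a b) (λ x → 𝟙 ⌊ x ~? a ⌋)) ⟩
          sum (λ x → 𝟙 ⌊ x ~? a ⌋) * R a b  ≡⟨ cong (_* R a b) (coset-size′ a) ⟩
          ∣ H ∣ * R a b                     ∎

      outsideCoset-size : ∀ g → sum (outsideCoset g) + ∣ H ∣ ≡ v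
      outsideCoset-size g = begin
        sum (outsideCoset g) + ∣ H ∣
          ≡⟨ cong₂ _+_ (sum-cong-≗ (λ x → sym (*-identityʳ (outsideCoset g x)))) (sym (*-identityʳ ∣ H ∣)) ⟩
        sum (λ x → outsideCoset g x * 1) + ∣ H ∣ * 1
          ≡⟨ sum-split-coset g (λ _ → 1) (λ _ → refl) ⟩
        sum {v} (λ _ → 1)
          ≡⟨ trans (sum-const v 1) (*-identityʳ v) ⟩
        v ∎
        where open ≡-Reasoning

      outsideCoset-sum : ∀ g → let c = cosetCount G D H in
        sum (λ x → outsideCoset g x * c x) + ∣ H ∣ * c g ≡ ∣ D ∣ * ∣ H ∣
      outsideCoset-sum g = trans (sum-split-coset g (cosetCount G D H) cosetCount-resp) sum-cosetCount

      outsideCoset-sum² : ∀ g → let c = cosetCount G D H in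
        sum (λ x → outsideCoset g x * (c x * c x)) + ∣ H ∣ * (c g * c g) ≡ ∣ H ∣ * pairSum D (𝟙∈ H)
      outsideCoset-sum² g =
        trans (sum-split-coset g (λ x → c x * c x) (λ g~x → cong₂ _*_ (cosetCount-resp g~x) (cosetCount-resp g~x)))
              sum-cosetCount²
        where
        c : Fin v → ℕ
        c = cosetCount G D H

import Data.Integer as ℤ
open ℤ using (+_; +<+; +≤+; positive)
open import Data.Integer.Properties using (pos-*)

variance-bound : ∀ {h k l r s P S N T : ℕ} → 0 < h →
  N + h ≡ r * h → S + h * s ≡ k * h → T + h * (s * s) ≡ h * P →
  P + l ≡ k + l * h → k * k + l ≡ k + l * (r * h) → S * S ≤ N * T →
  (+ (r * s) ℤ.- + k) ℤ.* (+ (r * s) ℤ.- + k) ℤ.≤ (+ k ℤ.- + l) ℤ.* ((+ r ℤ.- + 1) ℤ.* (+ r ℤ.- + 1))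
variance-bound {h} {k} {l} {r} {s} {P} {S} {N} {T} 0<h hN hS hT hP hE S²≤NT =
  subst (λ x → (x ℤ.- + k) ℤ.* (x ℤ.- + k) ℤ.≤ (+ k ℤ.- + l) ℤ.* ((+ r ℤ.- + 1) ℤ.* (+ r ℤ.- + 1)))
        (sym (pos-* r s))
        (IntegerArithmetic.variance-bound {+ h} {+ k} {+ l} {+ r} {+ s} {+ P} {+ S} {+ N} {+ T}
           {{positive (+<+ 0<h)}} hN′ hS′ hT′ hP′ hE′ S²≤NT′)
  where
  hN′ : + N ℤ.+ + h ≡ + r ℤ.* + h
  hN′ = trans (cong +_ hN) (pos-* r h)
  hS′ : + S ℤ.+ + h ℤ.* + s ≡ + k ℤ.* + h
  hS′ = trans (cong (λ x → + S ℤ.+ x) (sym (pos-* h s))) (trans (cong +_ hS) (pos-* k h))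
  hT′ : + T ℤ.+ + h ℤ.* (+ s ℤ.* + s) ≡ + h ℤ.* + P
  hT′ = trans (cong (λ x → + T ℤ.+ x) (sym (trans (pos-* h (s * s)) (cong (λ x → + h ℤ.* x) (pos-* s s)))))
              (trans (cong +_ hT) (pos-* h P))
  hP′ : + P ℤ.+ + l ≡ + k ℤ.+ + l ℤ.* + h
  hP′ = trans (cong +_ hP) (cong (λ x → + k ℤ.+ x) (pos-* l h))
  hE′ : + k ℤ.* + k ℤ.+ + l ≡ + k ℤ.+ + l ℤ.* (+ r ℤ.* + h)
  hE′ = trans (cong (λ x → x ℤ.+ + l) (sym (pos-* k k)))
              (trans (cong +_ hE) (cong (λ x → + k ℤ.+ x) (trans (pos-* l (r * h)) (cong (λ x → + l ℤ.* x) (pos-* r h)))))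
  S²≤NT′ : + S ℤ.* + S ℤ.≤ + N ℤ.* + T
  S²≤NT′ = subst₂ ℤ._≤_ (pos-* S S) (pos-* N T) (+≤+ S²≤NT)

theorem1p1 : ∀ {v k lam r s : ℕ} (G : FinAbGroup v) (D H : Subset v) →
    IsDifferenceSet G D k lam →
    IsSubgroup G H →
    r * ∣ H ∣ ≡ v →
    (g : Fin v) → cosetCount G D H g ≡ s →
    ((+ (r * s) ℤ.- + k) ℤ.* (+ (r * s) ℤ.- + k))
      ℤ.≤ ((+ k ℤ.- + lam) ℤ.* ((+ r ℤ.- + 1) ℤ.* (+ r ℤ.- + 1)))
theorem1p1 {v} {k} {lam} {r} G D H D-diff@(refl , _) H≤G@(ε∈H , _) r*∣H∣≡v g refl =
  variance-bound {r = r} {s = c g} {P = pairSum G D (𝟙∈ H)}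
                 {S = sum (λ x → w x * c x)} {N = sum w} {T = sum (λ x → w x * (c x * c x))}
    (x∈p⇒0<∣p∣ ε∈H)
    (trans (outsideCoset-size G H≤G D g) (sym r*∣H∣≡v))
    (outsideCoset-sum G H≤G D g)
    (outsideCoset-sum² G H≤G D g)
    (pairSum-subgroup G D-diff ε∈H)
    (subst (λ v′ → k * k + lam ≡ k + lam * v′) (sym r*∣H∣≡v) (k*k+λ≡k+λ*v G D-diff))
    (cauchy-schwarz w c)
  where
  c w : Fin v → ℕ
  c = cosetCount G D H
  w = outsideCoset G H≤G g
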